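{- Let $D$ be an $n\times n$ distance matrix and let $\mathcal{G}$ be a temporal graph on $[n]$ with $\mathrm{Fo}(\mathcal{G})=D$. Then for every entry $\tau=D_{uw}$ with $u\neq w$ (and $\tau<\infty$), there exists a vertex $v\in[n]$ such that $D_{uv}<\tau$ and the temporal edge $(\{v,w\},\tau)$ is $\mathrm{Fo}$-edge-compatible with $D$.
   Context: A temporal graph $\mathcal{G}=(G,\lambda)$ consists of a static undirected graph $G=(V,E)$ with $V=[n]$ and $\lambda:E\to 2^{\mathbb{N}_{>0}}$ giving the finite set of times each edge appears. A strict temporal $uv$-path is a path $u=v_0,\dots,v_k=v$ in $G$ with distinct vertices and times $\tau_1<\dots<\tau_k$, $\tau_i\in\lambda(\{v_{i-1},v_i\})$; arrival time $\tau_k$. $\mathrm{Fo}(\mathcal{G})$ is the $n\times n$ matrix with diagonal $0$ and entry $(u,v)$, $u\ne v$, the minimum arrival time of a strict temporal $uv$-path ($\infty$ if none). A distance matrix is an $n\times n$ matrix with entries in $\mathbb{N}\cup\{\infty\}$, zero exactly on the diagonal. A pair $(\{v,w\},\tau)$ with $\tau\in\mathbb{N}_{>0}$ is $\mathrm{Fo}$-edge-compatible with $D$ if for all $x\in[n]$: $D_{xv}<\tau\Rightarrow D_{xw}\le\tau$ and $D_{xw}<\tau\Rightarrow D_{xv}\le\tau$. -}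

module Defs where

open import Data.Nat using (ℕ; zero; suc; _<_; _≤_)
open import Data.Fin using (Fin)
open import Data.List using (List; []; _∷_; _++_)
open import Data.List.Membership.Propositional using (_∈_)
open import Data.List.Relation.Unary.Unique.Propositional using (Unique)
open import Data.Product using (Σ; ∃; _×_; _,_)
open import Relation.Binary.PropositionalEquality using (_≡_; _≢_)
open import Relation.Nullary using (¬_)

data ℕ∞ : Set where
  fin : ℕ → ℕ∞
  ∞   : ℕ∞

data _<∞_ : ℕ∞ → ℕ∞ → Set where
  fin<fin : ∀ {a b} → a < b → fin a <∞ fin b
  fin<∞   : ∀ {a} → fin a <∞ ∞

data _≤∞_ : ℕ∞ → ℕ∞ → Set where
  fin≤fin : ∀ {a b} → a ≤ b → fin a ≤∞ fin b
  x≤∞     : ∀ {x} → x ≤∞ ∞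

Matrix : ℕ → Set
Matrix n = Fin n → Fin n → ℕ∞

IsDistanceMatrix : ∀ {n} → Matrix n → Set
IsDistanceMatrix {n} D =
  (∀ (u v : Fin n) → D u v ≡ fin 0 → u ≡ v) × (∀ (v : Fin n) → D v v ≡ fin 0)

-- The label of the unordered
-- pair {u,v} is the finite set (list) labels u v of positive times; it is
-- symmetric, and there are no loops.  Pairs with an empty label list are
-- non-edges (they can never be used by a temporal path).
record TemporalGraph (n : ℕ) : Set where
  field
    labels    : Fin n → Fin n → List ℕ
    symmetric : ∀ u v → labels u v ≡ labels v u
    loopless  : ∀ v → labels v v ≡ []
    positive  : ∀ u v t → t ∈ labels u v → 0 < t
open TemporalGraph public

data TWalk {n} (G : TemporalGraph n) : Fin n → Fin n → ℕ → Set where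
  edge : ∀ {u v t} → t ∈ labels G u v → TWalk G u v t
  step : ∀ {u x v s t} → TWalk G u x s → s < t → t ∈ labels G x v → TWalk G u v t

-- the vertex sequence v₀ … v_k of a walk (in reverse order)
vertices : ∀ {n} {G : TemporalGraph n} {u v t} → TWalk G u v t → List (Fin n)
vertices {u = u} {v = v} (edge _) = v ∷ u ∷ []
vertices {v = v} (step w _ _) = v ∷ vertices w

TPath : ∀ {n} → TemporalGraph n → Fin n → Fin n → ℕ → Set
TPath G u v t = Σ (TWalk G u v t) λ w → Unique (vertices w)

IsFo : ∀ {n} → TemporalGraph n → Matrix n → Set
IsFo {n} G D =
  (∀ (v : Fin n) → D v v ≡ fin 0) ×
  (∀ (u v : Fin n) → u ≢ v →
     (D u v ≡ ∞ → ∀ t → ¬ TPath G u v t) ×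
     (∀ t → D u v ≡ fin t → TPath G u v t × (∀ t' → TPath G u v t' → t ≤ t')))

FoEdgeCompatible : ∀ {n} → Matrix n → Fin n → Fin n → ℕ → Set
FoEdgeCompatible {n} D v w τ =
  (0 < τ) ×
  (∀ (x : Fin n) → (D x v <∞ fin τ → D x w ≤∞ fin τ) ×
                   (D x w <∞ fin τ → D x v ≤∞ fin τ))

{-# OPTIONS --safe #-}
-- The optimal uw-path arriving at τ ends with an edge ({v,w},τ), and its prefix
-- reaches v before τ.  Any edge ({a,b},τ) of G is Fo-compatible: a vertex x
-- reaching a before τ either meets b on its optimal xa-path, whose prefix then
-- reaches b before τ, or extends that path by the edge to reach b at τ.
module Submission where

open import Defs
open import Data.Nat using (ℕ; _≤_; _<_; z≤n)
open import Data.Nat.Properties using (≤-refl; ≤-trans; ≤-<-trans; <⇒≤)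
open import Data.Fin using (Fin; _≟_)
open import Data.Product using (∃; _×_; _,_; proj₁; proj₂)
open import Data.List.Membership.Propositional using (_∈_)
open import Data.List.Relation.Unary.Any using (here; there)
open import Data.List.Relation.Unary.All.Properties using (¬Any⇒All¬)
import Data.List.Relation.Unary.All as All
open import Data.List.Relation.Unary.AllPairs using (_∷_; [])
open import Data.List.Relation.Unary.Unique.Propositional using (Unique)
open import Relation.Binary.PropositionalEquality using (_≡_; _≢_; refl; sym; subst)
open import Relation.Nullary using (yes; no)
open import Data.Empty using (⊥-elim)
open import Function using (_∘_)

≤∞-≤-trans : ∀ {x a b} → x ≤∞ fin a → a ≤ b → x ≤∞ fin b
≤∞-≤-trans (fin≤fin x≤a) a≤b = fin≤fin (≤-trans x≤a a≤b)

≤∞-<-trans : ∀ {x a b} → x ≤∞ fin a → a < b → x <∞ fin b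
≤∞-<-trans (fin≤fin x≤a) a<b = fin<fin (≤-<-trans x≤a a<b)

module _ {n : ℕ} {G : TemporalGraph n} where

  open import Data.List.Membership.DecPropositional (_≟_ {n}) using (_∈?_)

  label⇒≢ : ∀ {a b τ} → τ ∈ labels G a b → a ≢ b
  label⇒≢ {a} τ∈aa refl with () ← subst (_ ∈_) (loopless G a) τ∈aa

  edge-path : ∀ {a b τ} → τ ∈ labels G a b → TPath G a b τ
  edge-path {a} {b} p = edge p , (b≢a All.∷ All.[]) ∷ All.[] ∷ []
    where b≢a : b ≢ a
          b≢a = label⇒≢ p ∘ sym

  path-prefix : ∀ {x y z t} (W : TWalk G x y t) → Unique (vertices W) →
                z ∈ vertices W → z ≢ x → ∃ λ t' → t' ≤ t × TPath G x z t'
  path-prefix W@(edge _)     U (here refl)         _   = _ , ≤-refl , W , U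
  path-prefix (edge _)       _ (there (here refl)) z≢x = ⊥-elim (z≢x refl)
  path-prefix W@(step _ _ _) U (here refl)         _   = _ , ≤-refl , W , U
  path-prefix (step W s<t _) (_ ∷ U) (there z∈W) z≢x with path-prefix W U z∈W z≢x
  ... | t' , t'≤s , P = t' , ≤-trans t'≤s (<⇒≤ s<t) , P

  extend-or-shortcut : ∀ {x a b t τ} → TPath G x a t → t < τ → τ ∈ labels G a b →
                       b ≢ x → ∃ λ t' → t' ≤ τ × TPath G x b t'
  extend-or-shortcut {b = b} (W , U) t<τ p b≢x with b ∈? vertices W
  ... | no b∉W = _ , ≤-refl , step W t<τ p , ¬Any⇒All¬ _ b∉W ∷ U
  ... | yes b∈W with path-prefix W U b∈W b≢x
  ...   | t' , t'≤t , P = t' , ≤-trans t'≤t (<⇒≤ t<τ) , P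

  module _ {D : Matrix n} (fo : IsFo G D) where

    Fo-diag-≤ : ∀ {x t} → D x x ≤∞ fin t
    Fo-diag-≤ {x} = subst (_≤∞ fin _) (sym (proj₁ fo x)) (fin≤fin z≤n)

    Fo-shortest-path : ∀ {x y t} → x ≢ y → D x y ≡ fin t → TPath G x y t
    Fo-shortest-path x≢y Dxy≡t = proj₁ (proj₂ (proj₂ fo _ _ x≢y) _ Dxy≡t)

    Fo-≤-arrival : ∀ {x y t} → TPath G x y t → D x y ≤∞ fin t
    Fo-≤-arrival {x} {y} {t} P with x ≟ y
    ... | yes refl = Fo-diag-≤
    ... | no x≢y with D x y in Dxy≡
    ...   | fin s = fin≤fin (proj₂ (proj₂ (proj₂ fo x y x≢y) s Dxy≡) t P)
    ...   | ∞     = ⊥-elim (proj₁ (proj₂ fo x y x≢y) Dxy≡ t P)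

    Fo-<⇒path : ∀ {x y τ} → x ≢ y → D x y <∞ fin τ → ∃ λ t → t < τ × TPath G x y t
    Fo-<⇒path {x} {y} x≢y Dxy<τ with D x y in Dxy≡
    Fo-<⇒path x≢y (fin<fin t<τ) | fin t = t , t<τ , Fo-shortest-path x≢y Dxy≡

    Fo-last-edge : ∀ {u w τ} → TPath G u w τ → ∃ λ v → D u v <∞ fin τ × τ ∈ labels G v w
    Fo-last-edge (edge p , _)           = _ , ≤∞-<-trans Fo-diag-≤ (positive G _ _ _ p) , p
    Fo-last-edge (step W s<τ q , _ ∷ U) = _ , ≤∞-<-trans (Fo-≤-arrival (W , U)) s<τ , q

    Fo-reach-endpoint : ∀ {a b x τ} → τ ∈ labels G a b → D x a <∞ fin τ → D x b ≤∞ fin τ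
    Fo-reach-endpoint {a} {b} {x} p Dxa<τ with x ≟ b | x ≟ a
    ... | yes refl | _        = Fo-diag-≤
    ... | no _     | yes refl = Fo-≤-arrival (edge-path p)
    ... | no x≢b   | no x≢a with Fo-<⇒path x≢a Dxa<τ
    ...   | t , t<τ , P with extend-or-shortcut P t<τ p (x≢b ∘ sym)
    ...     | t' , t'≤τ , P' = ≤∞-≤-trans (Fo-≤-arrival P') t'≤τ

    label⇒FoEdgeCompatible : ∀ {a b τ} → τ ∈ labels G a b → FoEdgeCompatible D a b τ
    label⇒FoEdgeCompatible {a} {b} {τ} p =
      positive G a b τ p ,
      λ _ → Fo-reach-endpoint p , Fo-reach-endpoint (subst (τ ∈_) (symmetric G a b) p)

lemma3p8 : (n : ℕ) (D : Matrix n) (G : TemporalGraph n) →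
    IsDistanceMatrix D → IsFo G D →
    (u w : Fin n) (τ : ℕ) → u ≢ w → D u w ≡ fin τ →
    ∃ λ (v : Fin n) → (D u v <∞ fin τ) × FoEdgeCompatible D v w τ
lemma3p8 n D G _ fo u w τ u≢w Duw≡τ with Fo-last-edge fo (Fo-shortest-path fo u≢w Duw≡τ)
... | v , Duv<τ , τ∈vw = v , Duv<τ , label⇒FoEdgeCompatible fo τ∈vw
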